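{- (a) There is an algorithm which, given $k$ probability distributions $F^1,\dots,F^k$ on $n\ge2$ keys, outputs a valid level vector $L$ with $\max_s (F^s\cdot L)/\min_{L^*}(F^s\cdot L^*)\le\lceil\log_2 k\rceil+1$. (b) For every positive integer $k$ there exist $n$ and $k$ probability distributions $F^1,\dots,F^k$ on $n$ keys such that every valid level vector $L$ satisfies $\max_s (F^s\cdot L)/\min_{L^*}(F^s\cdot L^*)\ge\lfloor\log_2 k\rfloor+1$. Here minima range over valid level vectors $L^*$.
   Context: A vector $L\in\mathbb{Z}_{\ge0}^n$ is a valid level vector if there is a prefix-free binary code in which key $i$ has a codeword of length $L_i$ (equivalently a binary tree whose leaves are the keys, key $i$ at depth $L_i$, root at depth $0$). Cost: $F\cdot L=\sum_iF_iL_i$. Logarithms are base $2$.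
   Formalization: The distributions $F^1,\dots,F^k$ have only rational probabilities in part (a), and the distributions exhibited in part (b) are likewise taken with rational probabilities. -}

module Defs where

open import Data.Bool using (Bool)
open import Data.Nat using (ℕ; zero; suc)
open import Data.Fin using (Fin)
open import Data.List using (List; length; _++_)
open import Data.Product using (Σ; ∃; _×_)
open import Data.Integer using (+_)
open import Data.Rational using (ℚ; 0ℚ; 1ℚ; _+_; _*_; _/_; _≤_)
open import Relation.Binary.PropositionalEquality using (_≡_; _≢_)
open import Relation.Nullary using (¬_)

∑ : (n : ℕ) → (Fin n → ℚ) → ℚ
∑ zero    f = 0ℚ
∑ (suc n) f = f Fin.zero + ∑ n (λ i → f (Fin.suc i))

ℕ→ℚ : ℕ → ℚ
ℕ→ℚ m = (+ m) / 1

IsPrefix : List Bool → List Bool → Set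
IsPrefix u v = ∃ λ w → u ++ w ≡ v

PrefixFree : (n : ℕ) → (Fin n → List Bool) → Set
PrefixFree n c = ∀ (i j : Fin n) → i ≢ j → ¬ IsPrefix (c i) (c j)

ValidLevels : (n : ℕ) → (Fin n → ℕ) → Set
ValidLevels n L = Σ (Fin n → List Bool) λ c → PrefixFree n c × (∀ i → length (c i) ≡ L i)

IsDistribution : (n : ℕ) → (Fin n → ℚ) → Set
IsDistribution n F = (∀ i → 0ℚ ≤ F i) × ∑ n F ≡ 1ℚ

cost : (n : ℕ) → (Fin n → ℚ) → (Fin n → ℕ) → ℚ
cost n F L = ∑ n (λ i → F i * ℕ→ℚ (L i))

-- (a) Every distribution has an optimal code: squeezing a prefix-free code, i.e. keeping only
-- the bits read at branching nodes of its code tree, gives a prefix-free code that is pointwise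
-- no longer and has all codewords shorter than n, so a minimum over a finite list of codes
-- exists.  Key i is then encoded by the ⌈log₂ k⌉-bit index of a distribution s whose optimal
-- code Lˢ gives i the shortest codeword, followed by that codeword.  For every s its length is
-- at most ⌈log₂ k⌉ + Lˢᵢ ≤ (⌈log₂ k⌉ + 1) Lˢᵢ, as Lˢᵢ ≥ 1 once n ≥ 2.
-- (b) With m = ⌊log₂ k⌋, take 2^m + 1 keys and the point masses on the first 2^m of them.
-- Read the first m bits of a codeword, padded with zeros, as a number below 2^m: two of the
-- 2^m + 1 codewords share it, which is only possible if the one with the smaller index, a key
-- among the first 2^m, is longer than m.  Its point mass has optimal cost 1 but cost at least m + 1.

module Submission where

open import Defs
open import Data.Nat using (ℕ; _≤_)
open import Data.Nat.Logarithm using (⌈log₂_⌉; ⌊log₂_⌋)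
open import Data.Fin using (Fin)
open import Data.Product using (Σ; ∃; _×_)
open import Data.Rational using (ℚ; _*_)
open import Data.Rational using () renaming (_≤_ to _≤ℚ_)

open import Algebra.Bundles using (CommutativeMonoid; Ring)
open import Data.Bool using (Bool; true; false; not; if_then_else_; _≟_)
open import Data.Bool.Properties using (not-¬)
open import Data.Fin as Fin using (zero; suc; toℕ; fromℕ<)
import Data.Fin.Properties as FinP
open import Data.Integer using (+_; +≤+)
import Data.Integer.Properties as ℤP
open import Data.List as List using (List; []; _∷_; _++_; _∷ʳ_; length; replicate; filter; cartesianProductWith)
import Data.List.Extrema
import Data.List.Properties as ListP
open import Data.List.Membership.Propositional using (_∈_)
open import Data.List.Membership.Propositional.Properties
  using (∈-++⁺ˡ; ∈-++⁺ʳ; ∈-map⁺; ∈-filter⁺; ∈-cartesianProductWith⁺; ∈-allFin)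
import Data.List.Relation.Unary.All as All
open import Data.List.Relation.Unary.All.Properties using (all-filter)
open import Data.List.Relation.Unary.Any using (here; there)
open import Data.Nat as ℕ using (zero; suc; z≤n; s≤s; _<_; _^_; ⌊_/2⌋; ⌈_/2⌉)
open import Data.Nat.Coprimality using (1-coprimeTo) renaming (sym to coprime-sym)
open import Data.Nat.Logarithm.Core using (⌈log2⌉; ⌊log2⌋)
import Data.Nat.Properties as ℕP
open import Data.Product using (_,_; proj₁; proj₂)
open import Data.Rational as ℚ using (0ℚ; 1ℚ; mkℚ; *≤*; NonNegative)
import Data.Rational.Properties as ℚP
open import Data.Sum using (_⊎_; inj₁; inj₂)
open import Data.Vec using (Vec; []; _∷_; tabulate; count)
open import Data.Vec.Membership.Propositional.Properties using (∈-tabulate⁺)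
open import Data.Vec.Properties using (count≤n)
open import Data.Vec.Relation.Unary.Any as VecAny using (Any)
import Data.Vec.Functional as Vector
open import Function using (_∘_)
open import Induction.WellFounded using (Acc; acc)
open import Relation.Binary using (Decidable; DecTotalOrder)
open import Relation.Binary.PropositionalEquality
open import Relation.Nullary using (¬_; yes; no; does; contradiction)
open import Relation.Nullary.Decidable using (_×-dec_; _→-dec_; ¬?)
import Relation.Unary as U

open import Algebra.Properties.Semiring.Sum (Ring.semiring ℚP.+-*-ring)
  using (sum; sum-cong-≗; sum-replicate-zero; *-distribˡ-sum)
open import Algebra.Properties.CommutativeSemigroup
  (CommutativeMonoid.commutativeSemigroup ℚP.*-1-commutativeMonoid) using (x∙yz≈y∙xz)

-- Costs

ℕ→ℚ≡mkℚ : ∀ m → ℕ→ℚ m ≡ mkℚ (+ m) 0 (coprime-sym (1-coprimeTo m))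
ℕ→ℚ≡mkℚ m = ℚP.normalize-coprime (coprime-sym (1-coprimeTo m))

ℕ→ℚ-* : ∀ a b → ℕ→ℚ (a ℕ.* b) ≡ ℕ→ℚ a * ℕ→ℚ b
ℕ→ℚ-* a b rewrite ℕ→ℚ≡mkℚ a | ℕ→ℚ≡mkℚ b = cong (ℚ._/ 1) (ℤP.pos-* a b)

ℕ→ℚ-mono-≤ : ∀ {a b} → a ≤ b → ℕ→ℚ a ≤ℚ ℕ→ℚ b
ℕ→ℚ-mono-≤ {a} {b} a≤b rewrite ℕ→ℚ≡mkℚ a | ℕ→ℚ≡mkℚ b =
  *≤* (ℤP.*-monoʳ-≤-nonNeg (+ 1) (+≤+ a≤b))

ℕ→ℚ-nonNegative : ∀ m → NonNegative (ℕ→ℚ m)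
ℕ→ℚ-nonNegative m = ℚ.nonNegative (ℕ→ℚ-mono-≤ {0} {m} z≤n)

∑≡sum : ∀ n (f : Fin n → ℚ) → ∑ n f ≡ sum f
∑≡sum zero    f = refl
∑≡sum (suc n) f = cong (f zero ℚ.+_) (∑≡sum n (f ∘ suc))

∑-mono-≤ : ∀ n {f g : Fin n → ℚ} → (∀ i → f i ≤ℚ g i) → ∑ n f ≤ℚ ∑ n g
∑-mono-≤ zero    f≤g = ℚP.≤-refl
∑-mono-≤ (suc n) f≤g = ℚP.+-mono-≤ (f≤g zero) (∑-mono-≤ n (f≤g ∘ suc))

∑-cong : ∀ n {f g : Fin n → ℚ} → (∀ i → f i ≡ g i) → ∑ n f ≡ ∑ n g
∑-cong n {f} {g} f≗g = trans (∑≡sum n f) (trans (sum-cong-≗ f≗g) (sym (∑≡sum n g)))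

cost-mono-≤ : ∀ n {F : Fin n → ℚ} → (∀ i → 0ℚ ≤ℚ F i) →
              ∀ {L L′} → (∀ i → L i ≤ L′ i) → cost n F L ≤ℚ cost n F L′
cost-mono-≤ n {F} F≥0 L≤L′ =
  ∑-mono-≤ n (λ i → ℚP.*-monoˡ-≤-nonNeg (F i) {{ℚ.nonNegative (F≥0 i)}} (ℕ→ℚ-mono-≤ (L≤L′ i)))

cost-scale : ∀ n F a L → cost n F (λ i → a ℕ.* L i) ≡ ℕ→ℚ a * cost n F L
cost-scale n F a L = begin
  ∑ n (λ i → F i * ℕ→ℚ (a ℕ.* L i))     ≡⟨ ∑≡sum n _ ⟩
  sum (λ i → F i * ℕ→ℚ (a ℕ.* L i))     ≡⟨ sum-cong-≗ term ⟩
  sum (λ i → ℕ→ℚ a * (F i * ℕ→ℚ (L i))) ≡⟨ *-distribˡ-sum (ℕ→ℚ a) (λ i → F i * ℕ→ℚ (L i)) ⟨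
  ℕ→ℚ a * sum (λ i → F i * ℕ→ℚ (L i))   ≡⟨ cong (ℕ→ℚ a *_) (∑≡sum n _) ⟨
  ℕ→ℚ a * cost n F L                     ∎
  where
  open ≡-Reasoning
  term : ∀ i → F i * ℕ→ℚ (a ℕ.* L i) ≡ ℕ→ℚ a * (F i * ℕ→ℚ (L i))
  term i = trans (cong (F i *_) (ℕ→ℚ-* a (L i))) (x∙yz≈y∙xz (F i) (ℕ→ℚ a) (ℕ→ℚ (L i)))

-- Prefix-free codes

infix 4 _⊑_ _⊑?_

_⊑_ : List Bool → List Bool → Set
u ⊑ v = IsPrefix u v

⊑-refl : ∀ u → u ⊑ u
⊑-refl u = [] , ListP.++-identityʳ u

⊑-trans : ∀ {u v w} → u ⊑ v → v ⊑ w → u ⊑ w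
⊑-trans {u} (x , refl) (y , refl) = x ++ y , sym (ListP.++-assoc u x y)

∷-⊑⁺ : ∀ {b u v} → u ⊑ v → b ∷ u ⊑ b ∷ v
∷-⊑⁺ {b} (w , refl) = w , refl

∷-⊑⁻ : ∀ {b u v} → b ∷ u ⊑ b ∷ v → u ⊑ v
∷-⊑⁻ (w , e) = w , ListP.∷-injectiveʳ e

∷-⋢ : ∀ {b b′ u v} → b ≢ b′ → ¬ (b ∷ u ⊑ b′ ∷ v)
∷-⋢ b≢b′ (w , e) = b≢b′ (ListP.∷-injectiveˡ e)

_⊑?_ : Decidable _⊑_
[]      ⊑? v        = yes (v , refl)
(b ∷ u) ⊑? []       = no λ ()
(b ∷ u) ⊑? (b′ ∷ v) with b ≟ b′ | u ⊑? v
... | yes refl | yes u⊑v = yes (∷-⊑⁺ u⊑v)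
... | yes refl | no u⋢v  = no (u⋢v ∘ ∷-⊑⁻)
... | no b≢b′  | _       = no (∷-⋢ b≢b′)

∷ʳ-⊑-unique : ∀ {u b b′ w} → u ∷ʳ b ⊑ w → u ∷ʳ b′ ⊑ w → b ≡ b′
∷ʳ-⊑-unique {u} {b} {b′} (x , refl) (y , e) =
  ListP.∷-injectiveˡ (ListP.++-cancelˡ u (b ∷ x) (b′ ∷ y)
    (trans (sym (ListP.∷ʳ-++ u b x)) (trans (sym e) (ListP.∷ʳ-++ u b′ y))))

++-⊑⁻ : ∀ {u v x y} → length u ≡ length v → u ++ x ⊑ v ++ y → u ≡ v × x ⊑ y
++-⊑⁻ {[]}    {[]}    _ x⊑y = refl , x⊑y
++-⊑⁻ {b ∷ u} {b′ ∷ v} |u|≡|v| (w , e) with ++-⊑⁻ {u} {v} (ℕP.suc-injective |u|≡|v|) (w , ListP.∷-injectiveʳ e)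
... | refl , x⊑y = cong (_∷ u) (ListP.∷-injectiveˡ e) , x⊑y

lengths : ∀ {n} → (Fin n → List Bool) → Fin n → ℕ
lengths c i = length (c i)

prefixFree⇒valid : ∀ {n c} → PrefixFree n c → ValidLevels n (lengths c)
prefixFree⇒valid {c = c} pf = c , pf , λ _ → refl

prefixFree? : ∀ n → U.Decidable (PrefixFree n)
prefixFree? n c = FinP.all? λ i → FinP.all? λ j → ¬? (i FinP.≟ j) →-dec ¬? (c i ⊑? c j)

PrefixFree-resp-≗ : ∀ {n c c′} → (∀ i → c i ≡ c′ i) → PrefixFree n c → PrefixFree n c′
PrefixFree-resp-≗ c≗c′ pf i j i≢j = pf i j i≢j ∘ subst₂ _⊑_ (sym (c≗c′ i)) (sym (c≗c′ j))

prefixFree⇒nonempty : ∀ {n c} → 2 ≤ n → PrefixFree n c → ∀ i → 0 < length (c i)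
prefixFree⇒nonempty {suc zero}    (s≤s ())
prefixFree⇒nonempty {suc (suc n)} {c} _ pf i with c i in eq
... | []    = contradiction (subst (_⊑ c j) (sym eq) (c j , refl)) (pf i j (≢-sym (FinP.punchInᵢ≢i i zero)))
  where
  j : Fin (suc (suc n))
  j = Fin.punchIn i zero
... | _ ∷ _ = s≤s z≤n

unaryCode : ∀ n → Fin n → List Bool
unaryCode n i = replicate (toℕ i) true ∷ʳ false

unaryCode-prefixFree : ∀ n → PrefixFree n (unaryCode n)
unaryCode-prefixFree n i j i≢j = i≢j ∘ FinP.toℕ-injective ∘ unary-⊑-injective (toℕ i) (toℕ j)
  where
  unary-⊑-injective : ∀ a b → replicate a true ∷ʳ false ⊑ replicate b true ∷ʳ false → a ≡ b
  unary-⊑-injective zero    zero    _ = refl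
  unary-⊑-injective zero    (suc b) p = contradiction p (∷-⋢ λ ())
  unary-⊑-injective (suc a) zero    p = contradiction p (∷-⋢ λ ())
  unary-⊑-injective (suc a) (suc b) p = cong suc (unary-⊑-injective a b (∷-⊑⁻ p))

-- Squeezing a code

count-positive : ∀ {A : Set} {P : A → Set} (P? : U.Decidable P) →
                 ∀ {n} {xs : Vec A n} → Any P xs → 0 < count P? xs
count-positive P? {xs = x ∷ _} (VecAny.here px) with P? x
... | yes _  = s≤s z≤n
... | no ¬px = contradiction px ¬px
count-positive P? {xs = x ∷ _} (VecAny.there pxs) with does (P? x)
... | true  = s≤s z≤n
... | false = count-positive P? pxs

count-disjoint-≤ : ∀ {A : Set} {P Q R : A → Set}
                   (P? : U.Decidable P) (Q? : U.Decidable Q) (R? : U.Decidable R) →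
                   (∀ {x} → P x → R x) → (∀ {x} → Q x → R x) → (∀ {x} → P x → ¬ Q x) →
                   ∀ {n} (xs : Vec A n) → count P? xs ℕ.+ count Q? xs ≤ count R? xs
count-disjoint-≤ P? Q? R? P⇒R Q⇒R P⇒¬Q [] = z≤n
count-disjoint-≤ P? Q? R? P⇒R Q⇒R P⇒¬Q (x ∷ xs)
  with P? x | Q? x | R? x | count-disjoint-≤ P? Q? R? P⇒R Q⇒R P⇒¬Q xs
... | yes px | yes qx | _     | _  = contradiction qx (P⇒¬Q px)
... | yes px | no _   | no ¬r | _  = contradiction (P⇒R px) ¬r
... | no _   | yes qx | no ¬r | _  = contradiction (Q⇒R qx) ¬r
... | yes _  | no _   | yes _ | ih = s≤s ih
... | no _   | yes _  | yes _ | ih = subst (_≤ suc (count R? xs)) (sym (ℕP.+-suc (count P? xs) (count Q? xs))) (s≤s ih)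
... | no _   | no _   | yes _ | ih = ℕP.m≤n⇒m≤1+n ih
... | no _   | no _   | no _  | ih = ih

module Squeeze {n} (c : Fin n → List Bool) where

  Node : List Bool → Set
  Node u = Any (u ⊑_) (tabulate c)

  node? : U.Decidable Node
  node? u = VecAny.any? (u ⊑?_) (tabulate c)

  Node-++⁻ : ∀ u v → Node (u ++ v) → Node u
  Node-++⁻ u v = VecAny.map (⊑-trans (v , refl))

  Node-∷ʳ : ∀ u b x → Node (u ++ b ∷ x) → Node (u ∷ʳ b ++ x)
  Node-∷ʳ u b x = subst Node (sym (ListP.∷ʳ-++ u b x))

  Node-codeword : ∀ i → Node (c i)
  Node-codeword i = VecAny.map (λ { refl → ⊑-refl (c i) }) (∈-tabulate⁺ c i)

  Branching : List Bool → Set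
  Branching u = Node (u ∷ʳ false) × Node (u ∷ʳ true)

  branching? : U.Decidable Branching
  branching? u = node? (u ∷ʳ false) ×-dec node? (u ∷ʳ true)

  Branching-≢ : ∀ {u} b b′ → b ≢ b′ → Node (u ∷ʳ b) → Node (u ∷ʳ b′) → Branching u
  Branching-≢ false false b≢b′ _  _  = contradiction refl b≢b′
  Branching-≢ false true  _    n₀ n₁ = n₀ , n₁
  Branching-≢ true  false _    n₁ n₀ = n₀ , n₁
  Branching-≢ true  true  b≢b′ _  _  = contradiction refl b≢b′

  Branching⇒sibling : ∀ {u} b → Branching u → Node (u ∷ʳ not b)
  Branching⇒sibling false = proj₂
  Branching⇒sibling true  = proj₁

  squeeze : List Bool → List Bool → List Bool
  squeeze u []      = []
  squeeze u (b ∷ x) with branching? u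
  ... | yes _ = b ∷ squeeze (u ∷ʳ b) x
  ... | no _  = squeeze (u ∷ʳ b) x

  squeeze-length-≤ : ∀ u x → length (squeeze u x) ≤ length x
  squeeze-length-≤ u []      = z≤n
  squeeze-length-≤ u (b ∷ x) with branching? u
  ... | yes _ = s≤s (squeeze-length-≤ (u ∷ʳ b) x)
  ... | no _  = ℕP.m≤n⇒m≤1+n (squeeze-length-≤ (u ∷ʳ b) x)

  squeeze-⋢ : ∀ u x y → ¬ x ⊑ y → ¬ y ⊑ x → Node (u ++ x) → Node (u ++ y) → ¬ squeeze u x ⊑ squeeze u y
  squeeze-⋢ u []      y        x⋢y _   _  _  = contradiction (y , refl) x⋢y
  squeeze-⋢ u (b ∷ x) []       _   y⋢x _  _  = contradiction (_ , refl) y⋢x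
  squeeze-⋢ u (b ∷ x) (b′ ∷ y) x⋢y y⋢x nx ny with b ≟ b′
  ... | no b≢b′ with branching? u
  ...   | yes _         = ∷-⋢ b≢b′
  ...   | no ¬branching = contradiction (Branching-≢ b b′ b≢b′ nᵤb nᵤb′) ¬branching
    where
    nᵤb : Node (u ∷ʳ b)
    nᵤb = Node-++⁻ (u ∷ʳ b) x (Node-∷ʳ u b x nx)
    nᵤb′ : Node (u ∷ʳ b′)
    nᵤb′ = Node-++⁻ (u ∷ʳ b′) y (Node-∷ʳ u b′ y ny)
  squeeze-⋢ u (b ∷ x) (b ∷ y) x⋢y y⋢x nx ny | yes refl
    with branching? u
       | squeeze-⋢ (u ∷ʳ b) x y (x⋢y ∘ ∷-⊑⁺) (y⋢x ∘ ∷-⊑⁺) (Node-∷ʳ u b x nx) (Node-∷ʳ u b y ny)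
  ... | yes _ | ih = ih ∘ ∷-⊑⁻
  ... | no _  | ih = ih

  size : List Bool → ℕ
  size u = count (u ⊑?_) (tabulate c)

  size-children : ∀ u b → size (u ∷ʳ b) ℕ.+ size (u ∷ʳ not b) ≤ size u
  size-children u b = count-disjoint-≤ (u ∷ʳ b ⊑?_) (u ∷ʳ not b ⊑?_) (u ⊑?_)
    (⊑-trans (_ , refl)) (⊑-trans (_ , refl)) (λ p q → not-¬ refl (∷ʳ-⊑-unique p q)) (tabulate c)

  -- Each kept bit is read at a branching node, whose other child also lies on a codeword,
  -- so the number of codewords below the current node drops with every kept bit.
  squeeze-length-< : ∀ u x → Node (u ++ x) → length (squeeze u x) < size u
  squeeze-length-< u []      nx = count-positive (u ⊑?_) (subst Node (ListP.++-identityʳ u) nx)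
  squeeze-length-< u (b ∷ x) nx with branching? u | squeeze-length-< (u ∷ʳ b) x (Node-∷ʳ u b x nx)
  ... | yes branching | ih = begin
    2 ℕ.+ length (squeeze (u ∷ʳ b) x)        ≡⟨ ℕP.+-comm 1 (suc (length (squeeze (u ∷ʳ b) x))) ⟩
    suc (length (squeeze (u ∷ʳ b) x)) ℕ.+ 1  ≤⟨ ℕP.+-mono-≤ ih sibling-positive ⟩
    size (u ∷ʳ b) ℕ.+ size (u ∷ʳ not b)      ≤⟨ size-children u b ⟩
    size u                                   ∎
    where
    open ℕP.≤-Reasoning
    sibling-positive : 0 < size (u ∷ʳ not b)
    sibling-positive = count-positive (u ∷ʳ not b ⊑?_) (Branching⇒sibling b branching)
  ... | no _ | ih = ℕP.<-≤-trans ih (ℕP.≤-trans (ℕP.m≤m+n _ _) (size-children u b))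

  squeezed : Fin n → List Bool
  squeezed i = squeeze [] (c i)

  squeezed-prefixFree : PrefixFree n c → PrefixFree n squeezed
  squeezed-prefixFree pf i j i≢j =
    squeeze-⋢ [] (c i) (c j) (pf i j i≢j) (pf j i (≢-sym i≢j)) (Node-codeword i) (Node-codeword j)

  squeezed-length-≤ : ∀ i → length (squeezed i) ≤ length (c i)
  squeezed-length-≤ i = squeeze-length-≤ [] (c i)

  squeezed-length-< : ∀ i → length (squeezed i) < n
  squeezed-length-< i = ℕP.<-≤-trans (squeeze-length-< [] (c i) (Node-codeword i)) (count≤n ([] ⊑?_) (tabulate c))

-- Optimal codes

wordsUpTo : ℕ → List (List Bool)
wordsUpTo zero    = [] ∷ []
wordsUpTo (suc m) = [] ∷ List.map (false ∷_) (wordsUpTo m) ++ List.map (true ∷_) (wordsUpTo m)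

wordsUpTo-complete : ∀ {m} w → length w ≤ m → w ∈ wordsUpTo m
wordsUpTo-complete {zero}  []          _         = here refl
wordsUpTo-complete {suc m} []          _         = here refl
wordsUpTo-complete {suc m} (false ∷ w) (s≤s |w|≤m) =
  there (∈-++⁺ˡ (∈-map⁺ (false ∷_) (wordsUpTo-complete w |w|≤m)))
wordsUpTo-complete {suc m} (true ∷ w)  (s≤s |w|≤m) =
  there (∈-++⁺ʳ (List.map (false ∷_) (wordsUpTo m)) (∈-map⁺ (true ∷_) (wordsUpTo-complete w |w|≤m)))

functions : ∀ {A : Set} n → List A → List (Fin n → A)
functions zero    xs = (λ ()) ∷ []
functions (suc n) xs = cartesianProductWith Vector._∷_ xs (functions n xs)

functions-complete : ∀ {A : Set} n {xs : List A} (f : Fin n → A) → (∀ i → f i ∈ xs) →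
                     ∃ λ g → g ∈ functions n xs × (∀ i → g i ≡ f i)
functions-complete zero    f f∈xs = (λ ()) , here refl , λ ()
functions-complete (suc n) f f∈xs with functions-complete n (f ∘ suc) (f∈xs ∘ suc)
... | g , g∈ , g≗f =
  f zero Vector.∷ g , ∈-cartesianProductWith⁺ Vector._∷_ (f∈xs zero) g∈ , λ { zero → refl ; (suc i) → g≗f i }

shortCodes : ∀ n → List (Fin n → List Bool)
shortCodes n = filter (prefixFree? n) (functions n (wordsUpTo n))

shortCodes-complete : ∀ {n c} → PrefixFree n c → (∀ i → length (c i) ≤ n) →
                      ∃ λ g → g ∈ shortCodes n × (∀ i → g i ≡ c i)
shortCodes-complete {n} {c} pf short with functions-complete n c (λ i → wordsUpTo-complete (c i) (short i))
... | g , g∈ , g≗c = g , ∈-filter⁺ (prefixFree? n) g∈ (PrefixFree-resp-≗ (sym ∘ g≗c) pf) , g≗c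

module ℚMin = Data.List.Extrema (DecTotalOrder.totalOrder ℚP.≤-decTotalOrder)

codeCost : ∀ n → (Fin n → ℚ) → (Fin n → List Bool) → ℚ
codeCost n F c = cost n F (lengths c)

optimalCode : ∀ n → (Fin n → ℚ) → Fin n → List Bool
optimalCode n F = ℚMin.argmin (codeCost n F) (unaryCode n) (shortCodes n)

optimalCode-prefixFree : ∀ n F → PrefixFree n (optimalCode n F)
optimalCode-prefixFree n F =
  ℚMin.argmin-all (codeCost n F) (unaryCode-prefixFree n) (all-filter (prefixFree? n) (functions n (wordsUpTo n)))

optimalCode-optimal : ∀ n {F} → (∀ i → 0ℚ ≤ℚ F i) → ∀ {L} → ValidLevels n L →
                      cost n F (lengths (optimalCode n F)) ≤ℚ cost n F L
optimalCode-optimal n {F} F≥0 {L} (c , pf , |c|≡L) =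
  ℚP.≤-trans (All.lookup (ℚMin.f[argmin]≤f[xs] {f = codeCost n F} (unaryCode n) (shortCodes n)) g∈)
             (cost-mono-≤ n F≥0 g≤L)
  where
  open Squeeze c
  short : ∃ λ g → g ∈ shortCodes n × (∀ i → g i ≡ squeezed i)
  short = shortCodes-complete (squeezed-prefixFree pf) (λ i → ℕP.<⇒≤ (squeezed-length-< i))
  g : Fin n → List Bool
  g = proj₁ short
  g∈ : g ∈ shortCodes n
  g∈ = proj₁ (proj₂ short)
  g≤L : ∀ i → length (g i) ≤ L i
  g≤L i = subst₂ _≤_ (cong length (sym (proj₂ (proj₂ short) i))) (|c|≡L i) (squeezed-length-≤ i)

-- Fixed-width binary numerals

2^[1+m]≡2^m+2^m : ∀ m → 2 ^ suc m ≡ 2 ^ m ℕ.+ 2 ^ m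
2^[1+m]≡2^m+2^m m = cong (2 ^ m ℕ.+_) (ℕP.+-identityʳ (2 ^ m))

bitsValue : ℕ → List Bool → ℕ
bitsValue zero    _       = 0
bitsValue (suc m) []      = 0
bitsValue (suc m) (b ∷ w) = (if b then 2 ^ m else 0) ℕ.+ bitsValue m w

bitsValue-< : ∀ m w → bitsValue m w < 2 ^ m
bitsValue-< zero    w           = s≤s z≤n
bitsValue-< (suc m) []          = ℕP.m^n>0 2 (suc m)
bitsValue-< (suc m) (true ∷ w)  rewrite 2^[1+m]≡2^m+2^m m = ℕP.+-monoʳ-< (2 ^ m) (bitsValue-< m w)
bitsValue-< (suc m) (false ∷ w) rewrite 2^[1+m]≡2^m+2^m m = ℕP.<-≤-trans (bitsValue-< m w) (ℕP.m≤n+m (2 ^ m) (2 ^ m))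

bitsValue-comparable : ∀ m u v → length u ≤ m → bitsValue m u ≡ bitsValue m v → u ⊑ v ⊎ v ⊑ u
bitsValue-comparable m       []      v  _ _ = inj₁ (v , refl)
bitsValue-comparable (suc m) (b ∷ u) [] _ _ = inj₂ (b ∷ u , refl)
bitsValue-comparable (suc m) (true ∷ u) (true ∷ v) (s≤s |u|≤m) e =
  Data.Sum.map ∷-⊑⁺ ∷-⊑⁺ (bitsValue-comparable m u v |u|≤m (ℕP.+-cancelˡ-≡ (2 ^ m) _ _ e))
bitsValue-comparable (suc m) (false ∷ u) (false ∷ v) (s≤s |u|≤m) e =
  Data.Sum.map ∷-⊑⁺ ∷-⊑⁺ (bitsValue-comparable m u v |u|≤m e)
bitsValue-comparable (suc m) (true ∷ u) (false ∷ v) _ e =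
  contradiction (subst (2 ^ m ≤_) e (ℕP.m≤m+n (2 ^ m) (bitsValue m u))) (ℕP.<⇒≱ (bitsValue-< m v))
bitsValue-comparable (suc m) (false ∷ u) (true ∷ v) _ e =
  contradiction (subst (2 ^ m ≤_) (sym e) (ℕP.m≤m+n (2 ^ m) (bitsValue m v))) (ℕP.<⇒≱ (bitsValue-< m u))

toBits : ℕ → ℕ → List Bool
toBits zero    a = []
toBits (suc m) a with a ℕP.<? 2 ^ m
... | yes _ = false ∷ toBits m a
... | no _  = true ∷ toBits m (a ℕ.∸ 2 ^ m)

length-toBits : ∀ m a → length (toBits m a) ≡ m
length-toBits zero    a = refl
length-toBits (suc m) a with a ℕP.<? 2 ^ m
... | yes _ = cong suc (length-toBits m a)
... | no _  = cong suc (length-toBits m (a ℕ.∸ 2 ^ m))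

bitsValue-toBits : ∀ m a → a < 2 ^ m → bitsValue m (toBits m a) ≡ a
bitsValue-toBits zero    zero    _         = refl
bitsValue-toBits zero    (suc a) (s≤s ())
bitsValue-toBits (suc m) a a<2^[1+m] with a ℕP.<? 2 ^ m
... | yes a<2^m = bitsValue-toBits m a a<2^m
... | no a≮2^m  = trans (cong (2 ^ m ℕ.+_) (bitsValue-toBits m (a ℕ.∸ 2 ^ m) a∸2^m<2^m)) (ℕP.m+[n∸m]≡n 2^m≤a)
  where
  2^m≤a : 2 ^ m ≤ a
  2^m≤a = ℕP.≮⇒≥ a≮2^m
  a∸2^m<2^m : a ℕ.∸ 2 ^ m < 2 ^ m
  a∸2^m<2^m = ℕP.+-cancelˡ-< (2 ^ m) _ _
    (subst₂ _<_ (sym (ℕP.m+[n∸m]≡n 2^m≤a)) (2^[1+m]≡2^m+2^m m) a<2^[1+m])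

toBits-injective : ∀ m {a b} → a < 2 ^ m → b < 2 ^ m → toBits m a ≡ toBits m b → a ≡ b
toBits-injective m {a} {b} a< b< e =
  trans (sym (bitsValue-toBits m a a<)) (trans (cong (bitsValue m) e) (bitsValue-toBits m b b<))

-- ⌈log₂ n⌉ is ⌈log2⌉ n (<-wellFounded n), so both bounds go by induction along any accessibility proof.
n≤2^⌈log₂n⌉ : ∀ n → n ≤ 2 ^ ⌈log₂ n ⌉
n≤2^⌈log₂n⌉ n = go n _
  where
  go : ∀ n (acc : Acc _<_ n) → n ≤ 2 ^ ⌈log2⌉ n acc
  go zero                _        = z≤n
  go (suc zero)          _        = s≤s z≤n
  go (suc (suc n)) (acc rs) = begin
    suc (suc n)                       ≡⟨ cong (λ z → suc (suc z)) (ℕP.⌊n/2⌋+⌈n/2⌉≡n n) ⟨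
    suc (suc (⌊ n /2⌋ ℕ.+ ⌈ n /2⌉))   ≤⟨ s≤s (s≤s (ℕP.+-monoˡ-≤ ⌈ n /2⌉ (ℕP.⌊n/2⌋≤⌈n/2⌉ n))) ⟩
    suc (suc (⌈ n /2⌉ ℕ.+ ⌈ n /2⌉))   ≡⟨ cong suc (ℕP.+-suc ⌈ n /2⌉ ⌈ n /2⌉) ⟨
    suc ⌈ n /2⌉ ℕ.+ suc ⌈ n /2⌉       ≤⟨ ℕP.+-mono-≤ ih ih ⟩
    2 ^ r ℕ.+ 2 ^ r                   ≡⟨ 2^[1+m]≡2^m+2^m r ⟨
    2 ^ suc r                         ∎
    where
    open ℕP.≤-Reasoning
    r : ℕ
    r = ⌈log2⌉ (suc ⌈ n /2⌉) (rs (ℕP.⌈n/2⌉<n n))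
    ih : suc ⌈ n /2⌉ ≤ 2 ^ r
    ih = go (suc ⌈ n /2⌉) (rs (ℕP.⌈n/2⌉<n n))

2^⌊log₂n⌋≤n : ∀ n → 0 < n → 2 ^ ⌊log₂ n ⌋ ≤ n
2^⌊log₂n⌋≤n n = go n _
  where
  go : ∀ n (acc : Acc _<_ n) → 0 < n → 2 ^ ⌊log2⌋ n acc ≤ n
  go (suc zero)    _        _ = s≤s z≤n
  go (suc (suc n)) (acc rs) _ = begin
    2 ^ suc r                         ≡⟨ 2^[1+m]≡2^m+2^m r ⟩
    2 ^ r ℕ.+ 2 ^ r                   ≤⟨ ℕP.+-mono-≤ ih ih ⟩
    suc ⌊ n /2⌋ ℕ.+ suc ⌊ n /2⌋       ≡⟨ cong suc (ℕP.+-suc ⌊ n /2⌋ ⌊ n /2⌋) ⟩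
    suc (suc (⌊ n /2⌋ ℕ.+ ⌊ n /2⌋))   ≤⟨ s≤s (s≤s (ℕP.+-monoʳ-≤ ⌊ n /2⌋ (ℕP.⌊n/2⌋≤⌈n/2⌉ n))) ⟩
    suc (suc (⌊ n /2⌋ ℕ.+ ⌈ n /2⌉))   ≡⟨ cong (λ z → suc (suc z)) (ℕP.⌊n/2⌋+⌈n/2⌉≡n n) ⟩
    suc (suc n)                       ∎
    where
    open ℕP.≤-Reasoning
    r : ℕ
    r = ⌊log2⌋ (suc ⌊ n /2⌋) (rs (ℕP.⌊n/2⌋<n (suc n)))
    ih : 2 ^ r ≤ suc ⌊ n /2⌋
    ih = go (suc ⌊ n /2⌋) (rs (ℕP.⌊n/2⌋<n (suc n))) (s≤s z≤n)

-- The upper bound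

taggedCode : ∀ {k n} → (Fin k → List Bool) → (Fin k → Fin n → List Bool) → (Fin n → Fin k) →
             Fin n → List Bool
taggedCode tag c σ i = tag (σ i) ++ c (σ i) i

taggedCode-prefixFree : ∀ {k n} {tag : Fin k → List Bool} {c : Fin k → Fin n → List Bool}
                          {σ : Fin n → Fin k} →
                        (∀ s t → length (tag s) ≡ length (tag t)) → (∀ {s t} → tag s ≡ tag t → s ≡ t) →
                        (∀ s → PrefixFree n (c s)) → PrefixFree n (taggedCode tag c σ)
taggedCode-prefixFree {c = c} {σ} same-length tag-injective pf i j i≢j p
  with ++-⊑⁻ (same-length (σ i) (σ j)) p
... | tagᵢ≡tagⱼ , cᵢ⊑cⱼ =
  pf (σ i) i j i≢j (subst (λ s → c (σ i) i ⊑ c s j) (sym (tag-injective tagᵢ≡tagⱼ)) cᵢ⊑cⱼ)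

binaryTag : ∀ {k} ℓ → Fin k → List Bool
binaryTag ℓ s = toBits ℓ (toℕ s)

binaryTag-injective : ∀ {k} ℓ → k ≤ 2 ^ ℓ → ∀ {s t : Fin k} → binaryTag ℓ s ≡ binaryTag ℓ t → s ≡ t
binaryTag-injective ℓ k≤2^ℓ {s} {t} = FinP.toℕ-injective ∘ toBits-injective ℓ (bound s) (bound t)
  where
  bound : ∀ s → toℕ s < 2 ^ ℓ
  bound s = ℕP.<-≤-trans (FinP.toℕ<n s) k≤2^ℓ

module ℕMin = Data.List.Extrema ℕP.≤-totalOrder

argminFin : ∀ {k} → (Fin (suc k) → ℕ) → Fin (suc k)
argminFin f = ℕMin.argmin f zero (List.allFin _)

argminFin-minimal : ∀ {k} (f : Fin (suc k) → ℕ) s → f (argminFin f) ≤ f s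
argminFin-minimal f s = All.lookup (ℕMin.f[argmin]≤f[xs] {f = f} zero (List.allFin _)) (∈-allFin s)

bestSource : ∀ {k} n → (Fin (suc k) → Fin n → ℚ) → Fin n → Fin (suc k)
bestSource n F i = argminFin (λ s → length (optimalCode n (F s) i))

mixedCode : ∀ {k} n ℓ → (Fin (suc k) → Fin n → ℚ) → Fin n → List Bool
mixedCode n ℓ F = taggedCode (binaryTag ℓ) (optimalCode n ∘ F) (bestSource n F)

mixedCode-prefixFree : ∀ {k} n ℓ F → suc k ≤ 2 ^ ℓ → PrefixFree n (mixedCode n ℓ F)
mixedCode-prefixFree n ℓ F k<2^ℓ = taggedCode-prefixFree
  (λ s t → trans (length-toBits ℓ (toℕ s)) (sym (length-toBits ℓ (toℕ t))))
  (binaryTag-injective ℓ k<2^ℓ) (optimalCode-prefixFree n ∘ F)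

m+n≤[m+1]*n : ∀ m n → 0 < n → m ℕ.+ n ≤ (m ℕ.+ 1) ℕ.* n
m+n≤[m+1]*n m n@(suc _) _ = begin
  m ℕ.+ n               ≤⟨ ℕP.+-monoˡ-≤ n (ℕP.m≤m*n m n) ⟩
  m ℕ.* n ℕ.+ n         ≡⟨ cong (m ℕ.* n ℕ.+_) (ℕP.*-identityˡ n) ⟨
  m ℕ.* n ℕ.+ 1 ℕ.* n   ≡⟨ ℕP.*-distribʳ-+ n m 1 ⟨
  (m ℕ.+ 1) ℕ.* n       ∎
  where open ℕP.≤-Reasoning

mixedCode-length-≤ : ∀ {k} n ℓ F → 2 ≤ n → ∀ (s : Fin (suc k)) i →
                     length (mixedCode n ℓ F i) ≤ (ℓ ℕ.+ 1) ℕ.* length (optimalCode n (F s) i)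
mixedCode-length-≤ {k} n ℓ F 2≤n s i = begin
  length (binaryTag ℓ σ ++ optimalCode n (F σ) i) ≡⟨ ListP.length-++ (binaryTag ℓ σ) ⟩
  length (binaryTag ℓ σ) ℕ.+ Lᵢ σ                 ≡⟨ cong (ℕ._+ Lᵢ σ) (length-toBits ℓ (toℕ σ)) ⟩
  ℓ ℕ.+ Lᵢ σ                                      ≤⟨ ℕP.+-monoʳ-≤ ℓ (argminFin-minimal Lᵢ s) ⟩
  ℓ ℕ.+ Lᵢ s                                      ≤⟨ m+n≤[m+1]*n ℓ (Lᵢ s) Lᵢs-positive ⟩
  (ℓ ℕ.+ 1) ℕ.* Lᵢ s                              ∎
  where
  open ℕP.≤-Reasoning
  Lᵢ : Fin (suc k) → ℕ
  Lᵢ t = length (optimalCode n (F t) i)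
  σ : Fin (suc k)
  σ = bestSource n F i
  Lᵢs-positive : 0 < Lᵢ s
  Lᵢs-positive = prefixFree⇒nonempty 2≤n (optimalCode-prefixFree n (F s)) i

mixedCode-cost-≤ : ∀ {k} n ℓ F → 2 ≤ n → ∀ (s : Fin (suc k)) → (∀ i → 0ℚ ≤ℚ F s i) →
                   ∀ {L*} → ValidLevels n L* →
                   cost n (F s) (lengths (mixedCode n ℓ F)) ≤ℚ ℕ→ℚ (ℓ ℕ.+ 1) * cost n (F s) L*
mixedCode-cost-≤ n ℓ F 2≤n s F≥0 {L*} valid = begin
  cost n (F s) (lengths (mixedCode n ℓ F))       ≤⟨ cost-mono-≤ n F≥0 (mixedCode-length-≤ n ℓ F 2≤n s) ⟩
  cost n (F s) (λ i → (ℓ ℕ.+ 1) ℕ.* Lₛ i)        ≡⟨ cost-scale n (F s) (ℓ ℕ.+ 1) Lₛ ⟩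
  ℕ→ℚ (ℓ ℕ.+ 1) * cost n (F s) Lₛ               ≤⟨ ℚP.*-monoˡ-≤-nonNeg (ℕ→ℚ (ℓ ℕ.+ 1)) {{ℕ→ℚ-nonNegative (ℓ ℕ.+ 1)}}
                                                     (optimalCode-optimal n F≥0 valid) ⟩
  ℕ→ℚ (ℓ ℕ.+ 1) * cost n (F s) L*               ∎
  where
  open ℚP.≤-Reasoning
  Lₛ : Fin n → ℕ
  Lₛ = lengths (optimalCode n (F s))

mixedLevels : (k n : ℕ) → (Fin k → Fin n → ℚ) → Fin n → ℕ
mixedLevels zero    n F = λ _ → 0  -- junk: part (a) assumes k ≥ 1
mixedLevels (suc k) n F = lengths (mixedCode n ⌈log₂ suc k ⌉ F)

-- The lower bound

pointMass : ∀ {n} → Fin n → Fin n → ℚ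
pointMass zero    zero    = 1ℚ
pointMass zero    (suc _) = 0ℚ
pointMass (suc _) zero    = 0ℚ
pointMass (suc a) (suc j) = pointMass a j

∑-pointMass-* : ∀ n (a : Fin n) (x : Fin n → ℚ) → ∑ n (λ j → pointMass a j * x j) ≡ x a
∑-pointMass-* (suc n) zero x = begin
  1ℚ * x zero ℚ.+ ∑ n (λ j → 0ℚ * x (suc j)) ≡⟨ cong₂ ℚ._+_ (ℚP.*-identityˡ (x zero))
                                                            (∑-cong n (ℚP.*-zeroˡ ∘ x ∘ suc)) ⟩
  x zero ℚ.+ ∑ n (λ _ → 0ℚ)                  ≡⟨ cong (x zero ℚ.+_) (trans (∑≡sum n _) (sum-replicate-zero n)) ⟩
  x zero ℚ.+ 0ℚ                              ≡⟨ ℚP.+-identityʳ (x zero) ⟩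
  x zero                                     ∎
  where open ≡-Reasoning
∑-pointMass-* (suc n) (suc a) x =
  trans (cong₂ ℚ._+_ (ℚP.*-zeroˡ (x zero)) (∑-pointMass-* n a (x ∘ suc))) (ℚP.+-identityˡ (x (suc a)))

pointMass-isDistribution : ∀ n (a : Fin n) → IsDistribution n (pointMass a)
pointMass-isDistribution n a = nonNegative a , total
  where
  nonNegative : ∀ {n} (a j : Fin n) → 0ℚ ≤ℚ pointMass a j
  nonNegative zero    zero    = ℚP.nonNegative⁻¹ 1ℚ
  nonNegative zero    (suc _) = ℚP.≤-refl
  nonNegative (suc _) zero    = ℚP.≤-refl
  nonNegative (suc a) (suc j) = nonNegative a j
  total : ∑ n (pointMass a) ≡ 1ℚ
  total = trans (∑-cong n (sym ∘ ℚP.*-identityʳ ∘ pointMass a)) (∑-pointMass-* n a (λ _ → 1ℚ))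

cost-pointMass : ∀ n (a : Fin n) L → cost n (pointMass a) L ≡ ℕ→ℚ (L a)
cost-pointMass n a L = ∑-pointMass-* n a (ℕ→ℚ ∘ L)

depthOneCode : ∀ {n} → Fin n → Fin n → List Bool
depthOneCode {n} a j with a FinP.≟ j
... | yes _ = true ∷ []
... | no _  = false ∷ unaryCode n j

depthOneCode-prefixFree : ∀ {n} (a : Fin n) → PrefixFree n (depthOneCode a)
depthOneCode-prefixFree {n} a i j i≢j with a FinP.≟ i | a FinP.≟ j
... | yes refl | yes refl = contradiction refl i≢j
... | yes _    | no _     = ∷-⋢ λ ()
... | no _     | yes _    = ∷-⋢ λ ()
... | no _     | no _     = unaryCode-prefixFree n i j i≢j ∘ ∷-⊑⁻

length-depthOneCode : ∀ {n} (a : Fin n) → length (depthOneCode a a) ≡ 1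
length-depthOneCode a with a FinP.≟ a
... | yes _   = refl
... | no a≢a  = contradiction refl a≢a

pointMass-lowerBound : ∀ n (a : Fin n) {d} L → d ≤ L a →
                       ∃ λ L* → ValidLevels n L* × ℕ→ℚ d * cost n (pointMass a) L* ≤ℚ cost n (pointMass a) L
pointMass-lowerBound n a {d} L d≤Lₐ = L* , prefixFree⇒valid (depthOneCode-prefixFree a) , (begin
  ℕ→ℚ d * cost n (pointMass a) L* ≡⟨ cong (ℕ→ℚ d *_) (trans (cost-pointMass n a L*)
                                                             (cong ℕ→ℚ (length-depthOneCode a))) ⟩
  ℕ→ℚ d * 1ℚ                       ≡⟨ ℚP.*-identityʳ (ℕ→ℚ d) ⟩
  ℕ→ℚ d                            ≤⟨ ℕ→ℚ-mono-≤ d≤Lₐ ⟩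
  ℕ→ℚ (L a)                        ≡⟨ cost-pointMass n a L ⟨
  cost n (pointMass a) L           ∎)
  where
  open ℚP.≤-Reasoning
  L* : Fin n → ℕ
  L* = lengths (depthOneCode a)

prefixFree-longCodeword : ∀ m {c} → PrefixFree (suc (2 ^ m)) c → ∃ λ a → toℕ a < 2 ^ m × m < length (c a)
prefixFree-longCodeword m {c} pf with FinP.pigeonhole (ℕP.n<1+n (2 ^ m)) (λ a → fromℕ< (bitsValue-< m (c a)))
... | i , j , i<j , same = i , ℕP.<-≤-trans i<j (ℕ.s≤s⁻¹ (FinP.toℕ<n j)) , ℕP.≰⇒> cᵢ-not-short
  where
  i≢j : i ≢ j
  i≢j refl = ℕP.<-irrefl refl i<j
  equalValues : bitsValue m (c i) ≡ bitsValue m (c j)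
  equalValues = trans (sym (FinP.toℕ-fromℕ< _)) (trans (cong toℕ same) (FinP.toℕ-fromℕ< _))
  cᵢ-not-short : ¬ length (c i) ≤ m
  cᵢ-not-short |cᵢ|≤m =
    Data.Sum.[ pf i j i≢j , pf j i (≢-sym i≢j) ] (bitsValue-comparable m (c i) (c j) |cᵢ|≤m equalValues)

module HardInstance (k m : ℕ) (2^m≤k : 2 ^ m ≤ k) where

  keys : ℕ
  keys = suc (2 ^ m)

  target : Fin k → Fin keys
  target s = fromℕ< (s≤s (ℕP.m⊓n≤n (toℕ s) (2 ^ m)))

  F : Fin k → Fin keys → ℚ
  F = pointMass ∘ target

  target-onto : ∀ a → toℕ a < 2 ^ m → ∃ λ s → target s ≡ a
  target-onto a a<2^m = s , FinP.toℕ-injective (begin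
    toℕ (target s)       ≡⟨ FinP.toℕ-fromℕ< _ ⟩
    toℕ s ℕ.⊓ 2 ^ m      ≡⟨ cong (ℕ._⊓ 2 ^ m) (FinP.toℕ-fromℕ< _) ⟩
    toℕ a ℕ.⊓ 2 ^ m      ≡⟨ ℕP.m≤n⇒m⊓n≡m (ℕP.<⇒≤ a<2^m) ⟩
    toℕ a                ∎)
    where
    open ≡-Reasoning
    s : Fin k
    s = fromℕ< (ℕP.<-≤-trans a<2^m 2^m≤k)

  lowerBound : ∀ L → ValidLevels keys L →
               Σ (Fin k) λ s → Σ (Fin keys → ℕ) λ L* → ValidLevels keys L*
                 × ℕ→ℚ (m ℕ.+ 1) * cost keys (F s) L* ≤ℚ cost keys (F s) L
  lowerBound L (c , pf , |c|≡L) with prefixFree-longCodeword m pf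
  ... | a , a<2^m , m<|cₐ| with target-onto a a<2^m
  ... | s , refl = s , pointMass-lowerBound keys (target s) L (subst₂ _≤_ (ℕP.+-comm 1 m) (|c|≡L _) m<|cₐ|)

corollary1 :
    (Σ ((k n : ℕ) → (Fin k → Fin n → ℚ) → Fin n → ℕ) λ A →
      ∀ (k n : ℕ) → 1 ≤ k → 2 ≤ n → (F : Fin k → Fin n → ℚ) →
        (∀ s → IsDistribution n (F s)) →
        ValidLevels n (A k n F)
        × (∀ (s : Fin k) (L* : Fin n → ℕ) → ValidLevels n L* →
             cost n (F s) (A k n F) ≤ℚ (ℕ→ℚ (⌈log₂ k ⌉ Data.Nat.+ 1) * cost n (F s) L*)))
    ×
    (∀ (k : ℕ) → 1 ≤ k →
      Σ ℕ λ n → 2 ≤ n × Σ (Fin k → Fin n → ℚ) λ F →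
        (∀ s → IsDistribution n (F s))
        × (∀ (L : Fin n → ℕ) → ValidLevels n L →
             Σ (Fin k) λ s → Σ (Fin n → ℕ) λ L* → ValidLevels n L*
               × (ℕ→ℚ (⌊log₂ k ⌋ Data.Nat.+ 1) * cost n (F s) L* ≤ℚ cost n (F s) L)))
corollary1 =
  ( mixedLevels
  , λ { (suc k) n _ 2≤n F F-distribution →
          prefixFree⇒valid (mixedCode-prefixFree n ⌈log₂ suc k ⌉ F (n≤2^⌈log₂n⌉ (suc k)))
        , λ s L* → mixedCode-cost-≤ n ⌈log₂ suc k ⌉ F 2≤n s (proj₁ (F-distribution s)) } )
  , λ k 1≤k → let open HardInstance k ⌊log₂ k ⌋ (2^⌊log₂n⌋≤n k 1≤k) in
      keys , s≤s (ℕP.m^n>0 2 ⌊log₂ k ⌋) , F , pointMass-isDistribution keys ∘ target , lowerBound
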